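{- Every local class $\mathbf{K}$ enjoys the Adoptive Property.
   Context: A relational signature $\Sigma$ is locally finite if it has finitely many $n$-ary relation symbols for each $n$. General Irreflexivity axioms: for every $R\in\Sigma$ of arity $n\ge2$ and distinct $i,j$, $\forall\bar x\,(R(x_1,\dots,x_n)\to x_i\ne x_j)$. A local sentence has the form $\forall x_1\cdots\forall x_m(R(x_1,\dots,x_m)\to\psi)$, $m>0$, $R\in\Sigma$ of arity $m$, $\psi$ quantifier-free. A local class is the class $\mathbf{K}$ of all finite $\Sigma$-structures (for locally finite relational $\Sigma$) with underlying set a subset of $\mathbb{N}$ satisfying a set $\Phi$ of local sentences containing all General Irreflexivity axioms. For a structure $M$, $|M|$ is its underlying set and $R^M$ the interpretation of $R$. The $n$-frame $A^{(n)}$ of $A$ has the same underlying set, the same interpretations of relations of arity $\le n$, and empty interpretations of higher-arity relations. Adoptive Property: whenever $B\in\mathbf{K}$, $A\in\mathbf{K}$ is an (induced) substructure of $B$ of cardinality $n$, and $A'\in\mathbf{K}$ is a structure on $|A|$ with $(A')^{(n-1)}=A^{(n-1)}$, there is $B'\in\mathbf{K}$ with $|B'|=|B|$, $(B')^{(n-1)}=B^{(n-1)}$, and $R^{B'}=(R^B\setminus|A|^n)\cup R^{A'}$ for every $n$-ary $R\in\Sigma$. -}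

module Defs where

open import Data.Nat using (ℕ; suc; _<_)
open import Data.Fin using (Fin)
open import Data.Bool using (Bool; true; not; _∧_; _∨_)
open import Data.List using (List; length)
open import Data.List.Membership.Propositional using (_∈_)
open import Data.List.Relation.Unary.Unique.Propositional using (Unique)
open import Data.Vec using (Vec; lookup; map)
open import Data.Vec.Relation.Unary.All using (All)
open import Data.Product using (Σ; _×_)
open import Data.Sum using (_⊎_)
open import Relation.Nullary using (¬_; does)
open import Relation.Binary.PropositionalEquality using (_≡_; _≢_)
open import Data.Nat.Properties using (_≟_)

-- A locally finite relational signature is given by  sig : ℕ → ℕ ,
-- sig k = number of k-ary relation symbols; the k-ary symbols are  Fin (sig k).

module _ (sig : ℕ → ℕ) where

  -- Finite Σ-structures whose underlying set is a finite subset of ℕ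
  -- (a duplicate-free list); relations are decidable sets of k-tuples
  -- contained in |M|^k.
  record Structure : Set where
    field
      univ        : List ℕ
      univ-unique : Unique univ
      rel         : (k : ℕ) → Fin (sig k) → Vec ℕ k → Bool
      rel-in      : ∀ k (R : Fin (sig k)) (t : Vec ℕ k) →
                    rel k R t ≡ true → All (_∈ univ) t
  open Structure public

  data QF (m : ℕ) : Set where
    atom : (k : ℕ) → Fin (sig k) → Vec (Fin m) k → QF m
    eq   : Fin m → Fin m → QF m
    neg  : QF m → QF m
    and  : QF m → QF m → QF m
    or   : QF m → QF m → QF m

  eval : {m : ℕ} → Structure → QF m → Vec ℕ m → Bool
  eval M (atom k R xs) a = rel M k R (map (λ i → lookup a i) xs)
  eval M (eq i j)      a = does (lookup a i ≟ lookup a j)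
  eval M (neg ψ)       a = not (eval M ψ a)
  eval M (and ψ χ)     a = eval M ψ a ∧ eval M χ a
  eval M (or ψ χ)      a = eval M ψ a ∨ eval M χ a

  -- Local sentence  ∀ x_1 … x_m (R(x_1,…,x_m) → ψ)  with m = suc p > 0.
  record LocalSentence : Set where
    constructor local
    field
      p   : ℕ
      sym : Fin (sig (suc p))
      ψ   : QF (suc p)

  Sat : Structure → LocalSentence → Set
  Sat M (local p R ψ) =
    (a : Vec ℕ (suc p)) → All (_∈ univ M) a →
    rel M (suc p) R a ≡ true → eval M ψ a ≡ true

  GI : (q : ℕ) → Fin (sig (suc (suc q))) → Fin (suc (suc q)) → Fin (suc (suc q))
       → LocalSentence
  GI q R i j = local (suc q) R (neg (eq i j))

  ContainsGI : (LocalSentence → Set) → Set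
  ContainsGI Φ = ∀ q R i j → i ≢ j → Φ (GI q R i j)

  InK : (LocalSentence → Set) → Structure → Set
  InK Φ M = ∀ φ → Φ φ → Sat M φ

  SameUniv : Structure → Structure → Set
  SameUniv M N = ∀ x → (x ∈ univ M → x ∈ univ N) × (x ∈ univ N → x ∈ univ M)

  Substructure : Structure → Structure → Set
  Substructure A B =
    (∀ x → x ∈ univ A → x ∈ univ B) ×
    (∀ k (R : Fin (sig k)) (t : Vec ℕ k) → All (_∈ univ A) t → rel A k R t ≡ rel B k R t)

  -- Same interpretations of all relations of arity ≤ n-1, i.e. of arity k < n.
  -- Together with SameUniv this expresses  M^(n-1) = N^(n-1).
  SameBelow : ℕ → Structure → Structure → Set
  SameBelow n M N = ∀ k → k < n → ∀ (R : Fin (sig k)) (t : Vec ℕ k) → rel M k R t ≡ rel N k R t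

  Adoptive : (Structure → Set) → Set
  Adoptive K =
    (B A : Structure) → K B → K A → Substructure A B →
    (n : ℕ) → length (univ A) ≡ n →
    (A' : Structure) → K A' → SameUniv A' A → SameBelow n A' A →
    Σ Structure λ B' → K B' × SameUniv B' B × SameBelow n B' B ×
      (∀ (R : Fin (sig n)) (t : Vec ℕ n) →
        (rel B' n R t ≡ true →
           (rel B n R t ≡ true × ¬ All (_∈ univ A) t) ⊎ rel A' n R t ≡ true) ×
        ((rel B n R t ≡ true × ¬ All (_∈ univ A) t) ⊎ rel A' n R t ≡ true →
           rel B' n R t ≡ true))

-- B' keeps the relations of B of arity < n, takes those of A' on n-tuples inside |A| and those
-- of B on all other n-tuples, and has no relations of arity > n.  A local sentence instantiated
-- at a tuple a only inspects relations at tuples formed from entries of a.  By General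
-- Irreflexivity a related tuple has distinct entries, so no relation of arity > |a| holds there,
-- and an n-ary relation holding at such a tuple for an n-tuple a uses every entry of a.  Hence
-- around a tuple of length < n the structure B' looks like B, around an n-tuple inside |A| like A',
-- and around any other n-tuple like B; so B' inherits every local sentence from B or from A'.

module Submission where

open import Defs
open import Data.Bool using (Bool; true; false; not; _∧_; _∨_; if_then_else_)
open import Data.Bool.Properties using (¬-not)
open import Data.Fin using (Fin; zero; suc; punchOut) renaming (_≟_ to _≟ᶠ_)
open import Data.Fin.Properties using (any?; injective⇒≤; punchOut-injective)
open import Data.List.Membership.Propositional using (_∈_)
open import Data.Nat using (ℕ; suc; _<_; _≟_)
open import Data.List.Membership.DecPropositional _≟_ using (_∈?_)
open import Data.Nat.Properties using (<-cmp; <-irrefl; <-trans; <⇒≱; 1+n≰n)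
open import Data.Product using (∃; _×_; _,_; proj₁; proj₂)
open import Data.Sum using (_⊎_; inj₁; inj₂)
open import Data.Vec using (Vec; lookup; map)
open import Data.Vec.Properties using (lookup-map)
open import Data.Vec.Relation.Unary.All as All using (All; all?)
open import Data.Vec.Relation.Unary.All.Properties using (lookup⁺; lookup⁻; map⁺)
open import Function using (id)
open import Function.Definitions using (Injective)
open import Relation.Binary using (Tri; tri<; tri≈; tri>)
open import Relation.Binary.PropositionalEquality using (_≡_; _≢_; refl; sym; trans; cong; cong₂; subst)
open import Relation.Nullary using (¬_; Dec; yes; no; does; contradiction)
open import Relation.Nullary.Decidable using (dec-true; dec-false)

injective⇒surjective : ∀ {n} {f : Fin n → Fin n} → Injective _≡_ _≡_ f →
                       ∀ i → ∃ λ j → f j ≡ i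
injective⇒surjective {suc n} {f} f-inj i with any? (λ j → f j ≟ᶠ i)
... | yes hit = hit
... | no miss = contradiction (injective⇒≤ punched-inj) 1+n≰n
  where
  i≢f : ∀ j → i ≢ f j
  i≢f j e = miss (j , sym e)

  punched-inj : Injective _≡_ _≡_ (λ j → punchOut (i≢f j))
  punched-inj e = f-inj (punchOut-injective (i≢f _) (i≢f _) e)

All-lookup-map : ∀ {m k} {P : ℕ → Set} {a : Vec ℕ m} → All P a → (xs : Vec (Fin m) k) →
                 All P (map (lookup a) xs)
All-lookup-map pa xs = map⁺ (lookup⁻ (λ j → lookup⁺ pa (lookup xs j)))

module _ (sig : ℕ → ℕ) where

  AgreeAt : ∀ {m} → ℕ → Structure sig → Structure sig → Vec ℕ m → Set
  AgreeAt {m} k M N a =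
    ∀ (S : Fin (sig k)) (xs : Vec (Fin m) k) → rel M k S (map (lookup a) xs) ≡ rel N k S (map (lookup a) xs)

  AgreeOn : ∀ {m} → Structure sig → Structure sig → Vec ℕ m → Set
  AgreeOn M N a = ∀ k → AgreeAt k M N a

  eval-cong : ∀ {m} {M N : Structure sig} {a : Vec ℕ m} → AgreeOn M N a →
              (ψ : QF sig m) → eval sig M ψ a ≡ eval sig N ψ a
  eval-cong M≈N (atom k S xs) = M≈N k S xs
  eval-cong M≈N (eq i j)      = refl
  eval-cong M≈N (neg ψ)       = cong not (eval-cong M≈N ψ)
  eval-cong M≈N (and ψ χ)     = cong₂ _∧_ (eval-cong M≈N ψ) (eval-cong M≈N χ)
  eval-cong M≈N (or ψ χ)      = cong₂ _∨_ (eval-cong M≈N ψ) (eval-cong M≈N χ)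

module _ (sig : ℕ → ℕ) (Φ : LocalSentence sig → Set) (gi : ContainsGI sig Φ) where

  related⇒distinct : ∀ {M k} → InK sig Φ M → (S : Fin (sig k)) (t : Vec ℕ k) →
                     rel M k S t ≡ true → Injective _≡_ _≡_ (lookup t)
  related⇒distinct {k = suc 0} M∈K S t St {zero} {zero} _ = refl
  related⇒distinct {M} {suc (suc q)} M∈K S t St {i} {j} tᵢ≡tⱼ with i ≟ᶠ j
  ... | yes i≡j = i≡j
  ... | no i≢j = contradiction (subst (λ b → not b ≡ true) (dec-true (_ ≟ _) tᵢ≡tⱼ) GI-at-t) λ ()
    where
    GI-at-t : eval sig M (neg (eq i j)) t ≡ true
    GI-at-t = M∈K (GI sig q S i j) (gi q S i j i≢j) t (rel-in M _ S t St) St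

  instance-injective : ∀ {M m k} → InK sig Φ M → (S : Fin (sig k)) (a : Vec ℕ m) (xs : Vec (Fin m) k) →
                       rel M k S (map (lookup a) xs) ≡ true → Injective _≡_ _≡_ (lookup xs)
  instance-injective M∈K S a xs St {i} {j} e =
    related⇒distinct M∈K S (map (lookup a) xs) St
      (trans (lookup-map i (lookup a) xs) (trans (cong (lookup a) e) (sym (lookup-map j (lookup a) xs))))

  instance-unrelated-beyond : ∀ {M m k} → InK sig Φ M → m < k → (S : Fin (sig k)) (a : Vec ℕ m)
                              (xs : Vec (Fin m) k) → rel M k S (map (lookup a) xs) ≡ false
  instance-unrelated-beyond M∈K m<k S a xs =
    ¬-not λ St → <⇒≱ m<k (injective⇒≤ (instance-injective M∈K S a xs St))

  full-instance⇒All : ∀ {M m} {P : ℕ → Set} → InK sig Φ M → (S : Fin (sig m)) (a : Vec ℕ m)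
                      (xs : Vec (Fin m) m) → rel M m S (map (lookup a) xs) ≡ true →
                      All P (map (lookup a) xs) → All P a
  full-instance⇒All {P = P} M∈K S a xs St P-inst = lookup⁻ P-at
    where
    P-at : ∀ i → P (lookup a i)
    P-at i with j , xⱼ≡i ← injective⇒surjective (instance-injective M∈K S a xs St) i =
      subst P (trans (lookup-map j (lookup a) xs) (cong (lookup a) xⱼ≡i)) (lookup⁺ P-inst j)

  module Adoption (B A A' : Structure sig) (n : ℕ)
                  (B∈K : InK sig Φ B) (A'∈K : InK sig Φ A')
                  (A⊆B : Substructure sig A B) (A'≈A : SameUniv sig A' A)
                  (A'≈A-below : SameBelow sig n A' A) where

    Inside : ∀ {k} → Vec ℕ k → Set
    Inside t = All (_∈ univ A) t

    inside? : ∀ {k} (t : Vec ℕ k) → Dec (Inside t)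
    inside? = all? (_∈? univ A)

    A'-related⇒Inside : ∀ {k} (R : Fin (sig k)) (t : Vec ℕ k) → rel A' k R t ≡ true → Inside t
    A'-related⇒Inside R t Rt = All.map (proj₁ (A'≈A _)) (rel-in A' _ R t Rt)

    adopted-rel : (k : ℕ) → Fin (sig k) → Vec ℕ k → Bool
    adopted-rel k R t with <-cmp k n
    ... | tri< _ _ _    = rel B k R t
    ... | tri≈ _ refl _ = if does (inside? t) then rel A' k R t else rel B k R t
    ... | tri> _ _ _    = false

    adopted-rel-in : ∀ k (R : Fin (sig k)) (t : Vec ℕ k) → adopted-rel k R t ≡ true → All (_∈ univ B) t
    adopted-rel-in k R t Rt with <-cmp k n
    ... | tri< _ _ _    = rel-in B k R t Rt
    ... | tri> _ _ _    = contradiction Rt λ ()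
    ... | tri≈ _ refl _ with inside? t
    ...   | yes t⊆A = All.map (proj₁ A⊆B _) t⊆A
    ...   | no _    = rel-in B k R t Rt

    adopted : Structure sig
    adopted = record { univ = univ B ; univ-unique = univ-unique B ; rel = adopted-rel ; rel-in = adopted-rel-in }

    adopted-< : ∀ {k} {R : Fin (sig k)} {t : Vec ℕ k} → k < n → adopted-rel k R t ≡ rel B k R t
    adopted-< {k} k<n with <-cmp k n
    ... | tri< _ _ _     = refl
    ... | tri≈ k≮n _ _   = contradiction k<n k≮n
    ... | tri> k≮n _ _   = contradiction k<n k≮n

    adopted-> : ∀ {k} {R : Fin (sig k)} {t : Vec ℕ k} → n < k → adopted-rel k R t ≡ false
    adopted-> {k} n<k with <-cmp k n
    ... | tri< _ _ n≮k   = contradiction n<k n≮k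
    ... | tri≈ _ _ n≮k   = contradiction n<k n≮k
    ... | tri> _ _ _     = refl

    adopted-n : ∀ (R : Fin (sig n)) t → adopted-rel n R t ≡ (if does (inside? t) then rel A' n R t else rel B n R t)
    adopted-n R t with <-cmp n n
    ... | tri< n<n _ _   = contradiction n<n (<-irrefl refl)
    ... | tri≈ _ refl _  = refl
    ... | tri> _ _ n<n   = contradiction n<n (<-irrefl refl)

    adopted-inside : ∀ {R : Fin (sig n)} {t} → Inside t → adopted-rel n R t ≡ rel A' n R t
    adopted-inside {R} {t} t⊆A rewrite adopted-n R t | dec-true (inside? t) t⊆A = refl

    adopted-outside : ∀ {R : Fin (sig n)} {t} → ¬ Inside t → adopted-rel n R t ≡ rel B n R t
    adopted-outside {R} {t} t⊄A rewrite adopted-n R t | dec-false (inside? t) t⊄A = refl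

    agree-by-arity : ∀ {m} (N : Structure sig) (a : Vec ℕ m) →
                     (∀ {k} → k < n → AgreeAt sig k B N a) →
                     AgreeAt sig n adopted N a →
                     (∀ {k} → n < k → ∀ S xs → rel N k S (map (lookup a) xs) ≡ false) →
                     AgreeOn sig adopted N a
    agree-by-arity N a below at above k S xs = by-arity (<-cmp k n)
      where
      by-arity : Tri (k < n) (k ≡ n) (n < k) →
                 rel adopted k S (map (lookup a) xs) ≡ rel N k S (map (lookup a) xs)
      by-arity (tri< k<n _ _)  = trans (adopted-< k<n) (below k<n S xs)
      by-arity (tri≈ _ refl _) = at S xs
      by-arity (tri> _ _ n<k)  = trans (adopted-> n<k) (sym (above n<k S xs))

    adopted-n-≡-B : ∀ {R : Fin (sig n)} {t} → (Inside t → rel A' n R t ≡ rel B n R t) →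
                    adopted-rel n R t ≡ rel B n R t
    adopted-n-≡-B {t = t} A'≡B with inside? t
    ... | yes t⊆A = trans (adopted-inside t⊆A) (A'≡B t⊆A)
    ... | no t⊄A  = adopted-outside t⊄A

    agrees-below : ∀ {m} → m < n → (a : Vec ℕ m) → AgreeOn sig adopted B a
    agrees-below m<n a = agree-by-arity B a (λ _ _ _ → refl)
      (λ S xs → adopted-n-≡-B λ _ →
         trans (instance-unrelated-beyond A'∈K m<n S a xs) (sym (instance-unrelated-beyond B∈K m<n S a xs)))
      (λ n<k S → instance-unrelated-beyond B∈K (<-trans m<n n<k) S a)

    agrees-inside : (a : Vec ℕ n) → Inside a → AgreeOn sig adopted A' a
    agrees-inside a a⊆A = agree-by-arity A' a
      (λ k<n S xs → sym (trans (A'≈A-below _ k<n S _) (proj₂ A⊆B _ S _ (All-lookup-map a⊆A xs))))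
      (λ S xs → adopted-inside (All-lookup-map a⊆A xs))
      (λ n<k S → instance-unrelated-beyond A'∈K n<k S a)

    agrees-outside : (a : Vec ℕ n) → ¬ Inside a → AgreeOn sig adopted B a
    agrees-outside a a⊄A = agree-by-arity B a (λ _ _ _ → refl)
      (λ S xs → adopted-n-≡-B λ t⊆A → trans (unrelated A'∈K S xs t⊆A) (sym (unrelated B∈K S xs t⊆A)))
      (λ n<k S → instance-unrelated-beyond B∈K n<k S a)
      where
      unrelated : ∀ {M} → InK sig Φ M → (S : Fin (sig n)) (xs : Vec (Fin n) n) →
                  Inside (map (lookup a) xs) → rel M n S (map (lookup a) xs) ≡ false
      unrelated M∈K S xs t⊆A = ¬-not λ St → a⊄A (full-instance⇒All M∈K S a xs St t⊆A)

    adopted∈K : InK sig Φ adopted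
    adopted∈K (local p R ψ) φ∈Φ = by-arity (<-cmp (suc p) n)
      where
      by-arity : Tri (suc p < n) (suc p ≡ n) (n < suc p) → Sat sig adopted (local p R ψ)
      by-arity (tri< m<n _ _) a a∈B Ra =
        trans (eval-cong sig (agrees-below m<n a) ψ) (B∈K _ φ∈Φ a a∈B (trans (sym (adopted-< m<n)) Ra))
      by-arity (tri> _ _ n<m) a a∈B Ra = contradiction (trans (sym Ra) (adopted-> n<m)) λ ()
      by-arity (tri≈ _ refl _) a a∈B Ra with inside? a
      ... | yes a⊆A = trans (eval-cong sig (agrees-inside a a⊆A) ψ)
                        (A'∈K _ φ∈Φ a (All.map (proj₂ (A'≈A _)) a⊆A) (trans (sym (adopted-inside a⊆A)) Ra))
      ... | no a⊄A  = trans (eval-cong sig (agrees-outside a a⊄A) ψ)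
                        (B∈K _ φ∈Φ a a∈B (trans (sym (adopted-outside a⊄A)) Ra))

    adopted-n-spec : ∀ (R : Fin (sig n)) (t : Vec ℕ n) →
        (adopted-rel n R t ≡ true → (rel B n R t ≡ true × ¬ Inside t) ⊎ rel A' n R t ≡ true) ×
        ((rel B n R t ≡ true × ¬ Inside t) ⊎ rel A' n R t ≡ true → adopted-rel n R t ≡ true)
    adopted-n-spec R t with inside? t
    ... | yes t⊆A = (λ Rt → inj₂ (trans (sym (adopted-inside t⊆A)) Rt))
                  , λ { (inj₁ (_ , t⊄A)) → contradiction t⊆A t⊄A
                      ; (inj₂ A'Rt)      → trans (adopted-inside t⊆A) A'Rt }
    ... | no t⊄A  = (λ Rt → inj₁ (trans (sym (adopted-outside t⊄A)) Rt , t⊄A))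
                  , λ { (inj₁ (BRt , _)) → trans (adopted-outside t⊄A) BRt
                      ; (inj₂ A'Rt)      → contradiction (A'-related⇒Inside R t A'Rt) t⊄A }

proposition3p7 : (sig : ℕ → ℕ) (Φ : LocalSentence sig → Set) →
    ContainsGI sig Φ → Adoptive sig (InK sig Φ)
proposition3p7 sig Φ gi B A B∈K _ A⊆B n _ A' A'∈K A'≈A A'≈A-below =
  adopted , adopted∈K , (λ _ → id , id) , (λ k k<n R t → adopted-< k<n) , adopted-n-spec
  where open Adoption sig Φ gi B A A' n B∈K A'∈K A⊆B A'≈A A'≈A-below
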